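{- Let $T:\mathbb{Z}_{>0}\to\mathbb{Z}_{>0}$ be defined by $T(n)=(3n+1)/2$ if $n$ is odd and $T(n)=n/2$ if $n$ is even. For integers $j\ge 1$ and $0\le q\le j$, let $I_0(j,q)$ be the set of integers $n$ with $1\le n\le 2^j$ such that exactly $q$ of the $j$ integers $n, T(n), T^{(2)}(n),\ldots,T^{(j-1)}(n)$ are odd. Then for all integers $j\ge 1$ and $q\ge 0$ with $2q\le j$, $$\min I_0(j,q)=2^{j-2q}.$$
   Context: $T^{(k)}$ denotes the $k$-th iterate of $T$ (with $T^{(0)}$ the identity). -}

module Defs where

open import Data.Nat using (ℕ; zero; suc; _+_; _*_; _^_; _≤_)
open import Data.Nat.Base using (_/_; _%_)
open import Data.Bool using (Bool; true; false; if_then_else_)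
open import Data.Nat using (_≡ᵇ_)
open import Relation.Binary.PropositionalEquality using (_≡_)
open import Data.Product using (_×_)

isOdd : ℕ → Bool
isOdd n = (n % 2) ≡ᵇ 1

T : ℕ → ℕ
T n = if isOdd n then (3 * n + 1) / 2 else n / 2

iter : ℕ → ℕ → ℕ
iter zero    n = n
iter (suc k) n = T (iter k n)

oddCount : ℕ → ℕ → ℕ
oddCount zero    n = 0
oddCount (suc j) n = oddCount j n + (if isOdd (iter j n) then 1 else 0)

InI₀ : ℕ → ℕ → ℕ → Set
InI₀ j q n = (1 ≤ n) × (n ≤ 2 ^ j) × (oddCount j n ≡ q)

IsMinI₀ : ℕ → ℕ → ℕ → Set
IsMinI₀ j q m = InI₀ j q m × (∀ n → InI₀ j q n → m ≤ n)

module Submission where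

-- Write [n odd] ∈ {0,1} for the parity indicator.  One step of T
-- satisfies 2·T(n) = n when n is even and 2·T(n) = 3n+1 ≤ 4n when n is odd, i.e.
--     2·T(n) ≤ n · 4^[n odd].
-- Iterating this j times along the orbit of n ≥ 1 gives the lower bound
--     2^j ≤ n · 4^(oddCount j n).
-- Hence if n ∈ I₀(j,q) and j = m + 2q, then 2^m · 4^q ≤ n · 4^q, so n ≥ 2^m.
-- Conversely 2^m lies in I₀(j,q): its first m iterates are the even numbers
-- 2^m, …, 2 (halving), after which the orbit alternates 1, 2, 1, 2, … and
-- the remaining 2q steps contain exactly q odd terms.

open import Defs
open import Data.Nat using (ℕ; _+_; _*_; _∸_; _^_; _≤_)
open import Data.Nat.Base using (zero; suc; z≤n; s≤s; _/_)
open import Data.Nat.Properties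
open import Data.Nat.DivMod using (m*n%n≡0; [m+kn]%n≡m%n; m*n/n≡m)
open import Data.Bool using (if_then_else_)
open import Data.Product using (_,_)
open import Relation.Binary.PropositionalEquality
open import Data.Nat.Solver using (module +-*-Solver)
open +-*-Solver using (solve; _:=_; _:+_; _:*_; con)

data Parity : ℕ → Set where
  even : ∀ k → Parity (k * 2)
  odd  : ∀ k → Parity (1 + k * 2)

parity : ∀ n → Parity n
parity zero = even 0
parity (suc n) with parity n
... | even k = odd k
... | odd k  = even (suc k)

oddIndicator : ℕ → ℕ
oddIndicator n = if isOdd n then 1 else 0

oddIndicator-even : ∀ k → oddIndicator (k * 2) ≡ 0
oddIndicator-even k rewrite m*n%n≡0 k 2 {{_}} = refl

oddIndicator-odd : ∀ k → oddIndicator (1 + k * 2) ≡ 1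
oddIndicator-odd k rewrite [m+kn]%n≡m%n 1 k 2 {{_}} = refl

T-even : ∀ k → T (k * 2) ≡ k
T-even k rewrite m*n%n≡0 k 2 {{_}} = m*n/n≡m k 2

T-odd : ∀ k → T (1 + k * 2) ≡ 2 + k * 3
T-odd k rewrite [m+kn]%n≡m%n 1 k 2 {{_}} =
  trans (cong (_/ 2) three-n-plus-one) (m*n/n≡m (2 + k * 3) 2)
  where
  three-n-plus-one : 3 * (1 + k * 2) + 1 ≡ (2 + k * 3) * 2
  three-n-plus-one = solve 1 (λ x → con 3 :* (con 1 :+ x :* con 2) :+ con 1
                                  := (con 2 :+ x :* con 3) :* con 2) refl k

T-positive : ∀ n → 1 ≤ n → 1 ≤ T n
T-positive n n≥1 with parity n
T-positive .(0 * 2) () | even zero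
... | even (suc k) rewrite T-even (suc k) = s≤s z≤n
... | odd k        rewrite T-odd k        = s≤s z≤n

-- One-step estimate: 2·T(n) ≤ n · 4^[n odd] (equality for even n, 3n+1 ≤ 4n for odd n).
double-T-bound : ∀ n → 2 * T n ≤ n * 4 ^ oddIndicator n
double-T-bound n with parity n
... | even k rewrite T-even k | oddIndicator-even k =
  ≤-reflexive (trans (*-comm 2 k) (sym (*-identityʳ (k * 2))))
... | odd k rewrite T-odd k | oddIndicator-odd k = begin
  2 * (2 + k * 3)     ≡⟨ solve 1 (λ k → con 2 :* (con 2 :+ k :* con 3)
                                     := con 4 :+ k :* con 6) refl k ⟩
  4 + k * 6           ≤⟨ +-monoʳ-≤ 4 (*-monoʳ-≤ k (m≤n⇒m≤1+n (m≤n⇒m≤1+n ≤-refl))) ⟩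
  4 + k * 8           ≡⟨ solve 1 (λ k → con 4 :+ k :* con 8
                                     := (con 1 :+ k :* con 2) :* (con 4 :* con 1)) refl k ⟩
  (1 + k * 2) * 4 ^ 1 ∎
  where open ≤-Reasoning

iter-suc : ∀ k n → iter (suc k) n ≡ iter k (T n)
iter-suc zero    n = refl
iter-suc (suc k) n = cong T (iter-suc k n)

oddCount-head : ∀ j n → oddCount (suc j) n ≡ oddIndicator n + oddCount j (T n)
oddCount-head zero    n = +-comm 0 (oddIndicator n)
oddCount-head (suc j) n = begin
  oddCount (suc j) n + oddIndicator (iter (suc j) n)
    ≡⟨ cong₂ _+_ (oddCount-head j n) (cong oddIndicator (iter-suc j n)) ⟩
  oddIndicator n + oddCount j (T n) + oddIndicator (iter j (T n))
    ≡⟨ +-assoc (oddIndicator n) _ _ ⟩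
  oddIndicator n + oddCount (suc j) (T n) ∎
  where open ≡-Reasoning

-- Lower bound along the orbit: each odd term costs at most a factor 4,
-- each step gains a factor 2.
orbit-lower-bound : ∀ j n → 1 ≤ n → 2 ^ j ≤ n * 4 ^ oddCount j n
orbit-lower-bound zero    n n≥1 = ≤-trans n≥1 (≤-reflexive (sym (*-identityʳ n)))
orbit-lower-bound (suc j) n n≥1 = begin
  2 * 2 ^ j                  ≤⟨ *-monoʳ-≤ 2 (orbit-lower-bound j (T n) (T-positive n n≥1)) ⟩
  2 * (T n * 4 ^ c)          ≡⟨ *-assoc 2 (T n) (4 ^ c) ⟨
  2 * T n * 4 ^ c            ≤⟨ *-monoˡ-≤ (4 ^ c) (double-T-bound n) ⟩
  n * 4 ^ b * 4 ^ c          ≡⟨ *-assoc n (4 ^ b) (4 ^ c) ⟩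
  n * (4 ^ b * 4 ^ c)        ≡⟨ cong (n *_) (^-distribˡ-+-* 4 b c) ⟨
  n * 4 ^ (b + c)            ≡⟨ cong (λ e → n * 4 ^ e) (oddCount-head j n) ⟨
  n * 4 ^ oddCount (suc j) n ∎
  where
  open ≤-Reasoning
  b = oddIndicator n
  c = oddCount j (T n)

-- Once the orbit reaches 1 it alternates 1, 2, 1, 2, …: q odd terms per 2q steps.
oddCount-from-one : ∀ q → oddCount (2 * q) 1 ≡ q
oddCount-from-one zero    = refl
oddCount-from-one (suc q) = begin
  oddCount (2 * suc q) 1           ≡⟨ cong (λ j → oddCount j 1) (*-suc 2 q) ⟩
  oddCount (suc (suc (2 * q))) 1   ≡⟨ oddCount-head (suc (2 * q)) 1 ⟩
  1 + oddCount (suc (2 * q)) 2     ≡⟨ cong suc (oddCount-head (2 * q) 2) ⟩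
  1 + oddCount (2 * q) 1           ≡⟨ cong suc (oddCount-from-one q) ⟩
  suc q                            ∎
  where open ≡-Reasoning

-- The orbit of 2^m halves down to 1 without odd terms, then continues as above.
oddCount-power-of-two : ∀ m q → oddCount (m + 2 * q) (2 ^ m) ≡ q
oddCount-power-of-two zero    q = oddCount-from-one q
oddCount-power-of-two (suc m) q = begin
  oddCount (suc (m + 2 * q)) (2 * 2 ^ m)    ≡⟨ cong (oddCount (suc (m + 2 * q))) (*-comm 2 (2 ^ m)) ⟩
  oddCount (suc (m + 2 * q)) (2 ^ m * 2)    ≡⟨ oddCount-head (m + 2 * q) (2 ^ m * 2) ⟩
  oddIndicator (2 ^ m * 2) + oddCount (m + 2 * q) (T (2 ^ m * 2))
    ≡⟨ cong₂ _+_ (oddIndicator-even (2 ^ m)) (cong (oddCount (m + 2 * q)) (T-even (2 ^ m))) ⟩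
  oddCount (m + 2 * q) (2 ^ m)              ≡⟨ oddCount-power-of-two m q ⟩
  q                                         ∎
  where open ≡-Reasoning

lemma2p4 : ∀ (j q : ℕ) → 1 ≤ j → 2 * q ≤ j → IsMinI₀ j q (2 ^ (j ∸ 2 * q))
lemma2p4 j q _ 2q≤j = member , minimal
  where
  m = j ∸ 2 * q
  j≡m+2q : m + 2 * q ≡ j
  j≡m+2q = m∸n+n≡m 2q≤j

  2^j≡2^m*4^q : 2 ^ j ≡ 2 ^ m * 4 ^ q
  2^j≡2^m*4^q = begin
    2 ^ j               ≡⟨ cong (2 ^_) j≡m+2q ⟨
    2 ^ (m + 2 * q)     ≡⟨ ^-distribˡ-+-* 2 m (2 * q) ⟩
    2 ^ m * 2 ^ (2 * q) ≡⟨ cong (2 ^ m *_) (^-*-assoc 2 2 q) ⟨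
    2 ^ m * 4 ^ q       ∎
    where open ≡-Reasoning

  member : InI₀ j q (2 ^ m)
  member = m^n>0 2 m , ^-monoʳ-≤ 2 (m∸n≤m j (2 * q))
         , subst (λ i → oddCount i (2 ^ m) ≡ q) j≡m+2q (oddCount-power-of-two m q)

  minimal : ∀ n → InI₀ j q n → 2 ^ m ≤ n
  minimal n (n≥1 , _ , count≡q) = *-cancelʳ-≤ (2 ^ m) n (4 ^ q) {{m^n≢0 4 q}}
    (subst₂ _≤_ 2^j≡2^m*4^q (cong (λ c → n * 4 ^ c) count≡q) (orbit-lower-bound j n n≥1))
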